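{- Let $n\ge1$ and $D=(a,b)\in\mathrm{zLD}^2(n)$. Then $\psi(D)\in\mathrm{zRTT}_0(n)$.
   Context: $\mathrm{zLD}^2(n)$ is the set of pairs of sequences $(a,b)$ of positive integers of length $n$ with $a_i<a_{i+1}$ or $b_i<b_{i+1}$ for each $1\le i\le n-1$. A tiered rooted tree on $n+1$ vertices is a tree $T$ with vertex set $V$, $|V|=n+1$, a root $r$, and functions $w$ (label) and $\mathrm{lv}$ (level) on $V$ with $w(r)=\mathrm{lv}(r)=0$ and $w(v),\mathrm{lv}(v)\in\mathbb{Z}_{\ge1}$ for $v\neq r$, such that for every edge $\{u,v\}$ with $u,v\ne r$, $w(u)\ne w(v)$, $\mathrm{lv}(u)\ne\mathrm{lv}(v)$ and $w(u)<w(v)\iff\mathrm{lv}(u)<\mathrm{lv}(v)$, and distinct vertices with the same parent have different pairs $(w,\mathrm{lv})$. The parent $p(v)$ of $v\ne r$ is its neighbour closer to $r$; $u$ is a descendant of $v$ if $v=p^k(u)$ for some $k>0$. Vertices $u,v$ are compatible, $u\bowtie v$, if ($\mathrm{lv}(u)<\mathrm{lv}(v)$ and $w(u)<w(v)$) or ($\mathrm{lv}(u)>\mathrm{lv}(v)$ and $w(u)>w(v)$). A pair $(u,v)$ of non-root vertices is an inversion if $v$ is a descendant of $u$, $v\bowtie p(u)$, and either $w(v)<w(u)$ or ($w(v)=w(u)$ and $\mathrm{lv}(v)>\mathrm{lv}(u)$). $\mathrm{zRTT}_0(n)$ is the set of tiered rooted trees on $n+1$ vertices with no inversions. The construction $\psi(D)$: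 take vertices $v_0$ (the root, $w(v_0)=\mathrm{lv}(v_0)=0$) and $v_1,\dots,v_n$ with $w(v_i)=a_{n+1-i}$ and $\mathrm{lv}(v_i)=L+l-b_{n+1-i}$, where $L=\max_i b_i$, $l=\min_i b_i$. Define the total order $\prec_*$ on $v_1,\dots,v_n$: $v_i\prec_*v_j$ if $w(v_i)<w(v_j)$, or $w(v_i)=w(v_j)$ and $\mathrm{lv}(v_i)>\mathrm{lv}(v_j)$, or $w(v_i)=w(v_j)$, $\mathrm{lv}(v_i)=\mathrm{lv}(v_j)$ and $i<j$. Build the tree inductively: $T_0$ is the single vertex $v_0$; given $T_k$ on $v_0,\dots,v_k$ ($k<n$), let $v_{i_0}=v_0,v_{i_1},\dots,v_{i_s}=v_k$ be the path from the root to $v_k$ in $T_k$, and obtain $T_{k+1}$ by making $v_{k+1}$ a child of $v_{i_m}$, where $m=\min\big(\{0\le j<s: v_{k+1}\bowtie v_{i_j},\ v_{k+1}\prec_* v_{i_{j+1}}\}\cup\{s\}\big)$. Then $\psi(D)=T_n$. -}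

module Defs where

open import Data.Nat using (ℕ; zero; suc; _+_; _∸_; _≤_; _<_; _⊔_; _⊓_; _<ᵇ_; _≡ᵇ_)
open import Data.Fin using (Fin; zero; suc; toℕ; opposite; inject₁; _≟_)
open import Data.Bool using (Bool; true; false; _∧_; _∨_; if_then_else_)
open import Data.List using (List; []; _∷_; _∷ʳ_; foldl)
open import Data.List using (allFin)
open import Data.Product using (Σ; ∃; _×_; _,_; proj₁)
open import Data.Sum using (_⊎_)
open import Relation.Binary.PropositionalEquality using (_≡_; _≢_)
open import Relation.Nullary using (¬_; does)
open import Function.Bundles using (_⇔_)

IsZLD2 : (n : ℕ) → (a b : Fin n → ℕ) → Set
IsZLD2 n a b =
  (∀ i → 1 ≤ a i) × (∀ i → 1 ≤ b i) ×
  (∀ (i j : Fin n) → toℕ j ≡ suc (toℕ i) → (a i < a j) ⊎ (b i < b j))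

-- Vertex set Fin (suc n), root
-- is zero; the tree is given by the parent of every non-root vertex
-- (par j = parent of vertex suc j), together with labels w and levels lv.

record LTree (n : ℕ) : Set where
  field
    w   : Fin (suc n) → ℕ
    lv  : Fin (suc n) → ℕ
    par : Fin n → Fin (suc n)

  -- parent map extended to the root by the (harmless) convention p(r) = r
  parent : Fin (suc n) → Fin (suc n)
  parent zero    = zero
  parent (suc j) = par j

iter : {A : Set} → (A → A) → ℕ → A → A
iter f zero    x = x
iter f (suc k) x = f (iter f k x)

module _ {n : ℕ} (T : LTree n) where
  open LTree T

  IsRootedTree : Set
  IsRootedTree = ∀ v → ∃ λ k → iter parent k v ≡ zero

  Descendant : Fin (suc n) → Fin (suc n) → Set
  Descendant u v = ∃ λ k → iter parent (suc k) u ≡ v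

  Compat : Fin (suc n) → Fin (suc n) → Set
  Compat u v = (lv u < lv v × w u < w v) ⊎ (lv v < lv u × w v < w u)

  IsTiered : Set
  IsTiered =
    IsRootedTree ×
    (w zero ≡ 0 × lv zero ≡ 0) ×
    (∀ j → 1 ≤ w (suc j) × 1 ≤ lv (suc j)) ×
    (∀ j → par j ≢ zero →
       w (suc j) ≢ w (par j) × lv (suc j) ≢ lv (par j) ×
       (w (suc j) < w (par j) ⇔ lv (suc j) < lv (par j))) ×
    (∀ i j → i ≢ j → par i ≡ par j →
       ¬ (w (suc i) ≡ w (suc j) × lv (suc i) ≡ lv (suc j)))

  Inversion : Fin n → Fin n → Set
  Inversion u v =
    Descendant (suc v) (suc u) × Compat (suc v) (par u) ×
    ((w (suc v) < w (suc u)) ⊎ (w (suc v) ≡ w (suc u) × lv (suc u) < lv (suc v)))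

  NoInversions : Set
  NoInversions = ∀ u v → ¬ Inversion u v

InZRTT0 : {n : ℕ} → LTree n → Set
InZRTT0 T = IsTiered T × NoInversions T

maxF : (n : ℕ) → (Fin n → ℕ) → ℕ
maxF zero    f = 0
maxF (suc n) f = f zero ⊔ maxF n (λ i → f (suc i))

minF : (n : ℕ) → (Fin n → ℕ) → ℕ
minF zero          f = 0
minF (suc zero)    f = f zero
minF (suc (suc n)) f = f zero ⊓ minF (suc n) (λ i → f (suc i))

module Psi (n : ℕ) (a b : Fin n → ℕ) where

  L l : ℕ
  L = maxF n b
  l = minF n b

  -- v_i = vertex i;  w(v_i) = a_{n+1-i}, lv(v_i) = L + l - b_{n+1-i}
  -- (with 0-indexed a, b : index n+1-i (1-based) of vertex suc j is opposite j)
  wψ : Fin (suc n) → ℕ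
  wψ zero    = 0
  wψ (suc j) = a (opposite j)

  lvψ : Fin (suc n) → ℕ
  lvψ zero    = 0
  lvψ (suc j) = L + l ∸ b (opposite j)

  compatᵇ : Fin (suc n) → Fin (suc n) → Bool
  compatᵇ x y = ((lvψ x <ᵇ lvψ y) ∧ (wψ x <ᵇ wψ y)) ∨ ((lvψ y <ᵇ lvψ x) ∧ (wψ y <ᵇ wψ x))

  precᵇ : Fin (suc n) → Fin (suc n) → Bool
  precᵇ x y = (wψ x <ᵇ wψ y)
            ∨ ((wψ x ≡ᵇ wψ y) ∧ (lvψ y <ᵇ lvψ x))
            ∨ ((wψ x ≡ᵇ wψ y) ∧ (lvψ x ≡ᵇ lvψ y) ∧ (toℕ x <ᵇ toℕ y))

  -- path from the root to v in the tree with parent map p (fuel bounds depth)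
  pathTo : ℕ → (Fin (suc n) → Fin (suc n)) → Fin (suc n) → List (Fin (suc n))
  pathTo zero    p v       = v ∷ []
  pathTo (suc f) p zero    = zero ∷ []
  pathTo (suc f) p (suc j) = pathTo f p (p (suc j)) ∷ʳ suc j

  -- given the path v_{i_0}, …, v_{i_s}, return v_{i_m} with
  -- m = min({j < s : x ⋈ v_{i_j}, x ≺* v_{i_{j+1}}} ∪ {s})
  choose : Fin (suc n) → List (Fin (suc n)) → Fin (suc n)
  choose x []             = zero
  choose x (u ∷ [])       = u
  choose x (u ∷ u' ∷ rest) =
    if compatᵇ x u ∧ precᵇ x u' then u else choose x (u' ∷ rest)

  -- one step: T_k ↦ T_{k+1}, where the new vertex is v_{k+1} = suc j,
  -- and the current last vertex is v_k = inject₁ j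
  step : (Fin (suc n) → Fin (suc n)) → Fin n → (Fin (suc n) → Fin (suc n))
  step p j v with does (v ≟ suc j)
  ... | true  = choose (suc j) (pathTo (suc n) p (inject₁ j))
  ... | false = p v

  -- parent map of T_n (starting from T_0, all vertices attached nowhere yet)
  parentψ : Fin (suc n) → Fin (suc n)
  parentψ = foldl step (λ _ → zero) (allFin n)

ψ : (n : ℕ) → (a b : Fin n → ℕ) → LTree n
ψ n a b = record { w = wψ ; lv = lvψ ; par = λ j → parentψ (suc j) }
  where open Psi n a b

{-# OPTIONS --safe #-}
-- The fold attaches v_{k+1} by walking down the root path of v_k, and reads only parents fixed
-- earlier, so the final parent map obeys the attachment rule at every vertex.  Each tiered-tree
-- condition is then a property of such a walk: the vertex where it stops is ⋈-comparable to
-- v_{k+1} thanks to the zLD² condition between v_k and v_{k+1}; minimality of the stopping index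
-- rules out inversions; and since every vertex hangs on the root path of its predecessor,
-- siblings are strictly ≺-ordered by age, so they carry distinct (w, lv).
module Submission where

open import Defs
open import Data.Nat using (ℕ; _≤_)
open import Data.Fin using (Fin)

open import Level using (0ℓ)
open import Data.Nat using (zero; suc; _+_; _∸_; _<_; z≤n; s≤s)
open import Data.Nat.Properties renaming (_≟_ to _≟ℕ_)
open import Data.Fin using (zero; suc; toℕ; inject₁; opposite; _≟_)
open import Data.Fin.Properties using (toℕ-injective; toℕ-inject₁; toℕ<n; toℕ≤pred[n])
import Data.Fin.Properties as Finₚ
open import Data.Fin.Induction using (<-wellFounded)
open import Induction.WellFounded as WF using ()
open import Data.Bool using (if_then_else_)
open import Data.List using (List; []; _∷_; _∷ʳ_; foldl; tabulate; allFin)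
open import Data.List.Relation.Unary.All as All using (All; []; _∷_)
open import Data.List.Relation.Unary.All.Properties using (∷ʳ⁺)
open import Data.Product using (∃; _×_; _,_; proj₁; proj₂)
open import Data.Sum using (_⊎_; inj₁; inj₂)
open import Data.Empty using (⊥-elim)
open import Function using (id; _∘_)
open import Function.Bundles using (_⇔_; mk⇔)
open import Relation.Binary.Definitions using (tri<; tri≈; tri>)
open import Relation.Binary.PropositionalEquality
open import Relation.Nullary using (¬_; Dec; does; yes; no; _×-dec_; _⊎-dec_)

iter-suc : ∀ {A : Set} (f : A → A) k x → iter f (suc k) x ≡ iter f k (f x)
iter-suc f zero    x = refl
iter-suc f (suc k) x = cong f (iter-suc f k x)

iter-+ : ∀ {A : Set} (f : A → A) i k x → iter f i (iter f k x) ≡ iter f (i + k) x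
iter-+ f zero    k x = refl
iter-+ f (suc i) k x = cong f (iter-+ f i k x)

if-does : ∀ {A B : Set} (Pr : A → Set) (d : Dec B) {x y : A} →
          (B → Pr x) → (¬ B → Pr y) → Pr (if does d then x else y)
if-does Pr (yes b)  onYes onNo = onYes b
if-does Pr (no ¬b) onYes onNo = onNo ¬b

<-strongInduction : ∀ {m} (Pr : Fin m → Set) →
                    (∀ i → (∀ {j} → toℕ j < toℕ i → Pr j) → Pr i) → ∀ i → Pr i
<-strongInduction = WF.All.wfRec <-wellFounded 0ℓ

foldl-allFin-invariant : ∀ {n} {A : Set} (I : ℕ → A → Set) (f : A → Fin n → A) →
  (∀ {t x} j → toℕ j ≡ t → I t x → I (suc t) (f x j)) →
  ∀ {x} → I 0 x → I n (foldl f x (allFin n))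
foldl-allFin-invariant {n} I f step I₀ = go n id 0 (λ _ → refl) I₀
  where
  go : ∀ m (g : Fin m → Fin n) t {x} → (∀ i → toℕ (g i) ≡ t + toℕ i) →
       I t x → I (t + m) (foldl f x (tabulate g))
  go zero    g t {x} hg It = subst (λ s → I s x) (sym (+-identityʳ t)) It
  go (suc m) g t {x} hg It =
    subst (λ s → I s (foldl f (f x (g zero)) (tabulate (g ∘ suc)))) (sym (+-suc t m))
      (go m (g ∘ suc) (suc t) (λ i → trans (hg (suc i)) (+-suc t (toℕ i)))
        (step (g zero) (trans (hg zero) (+-identityʳ t)) It))

maxF-upperBound : ∀ m (f : Fin m → ℕ) i → f i ≤ maxF m f
maxF-upperBound (suc m) f zero    = m≤m⊔n (f zero) _
maxF-upperBound (suc m) f (suc i) = ≤-trans (maxF-upperBound m (f ∘ suc) i) (m≤n⊔m (f zero) _)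

minF-glb : ∀ {k} m (f : Fin m → ℕ) → 1 ≤ m → (∀ i → k ≤ f i) → k ≤ minF m f
minF-glb (suc zero)    f _ k≤f = k≤f zero
minF-glb (suc (suc m)) f _ k≤f = ⊓-glb (k≤f zero) (minF-glb (suc m) (f ∘ suc) (s≤s z≤n) (k≤f ∘ suc))

opposite-inject₁ : ∀ {m} (i : Fin m) → opposite (inject₁ i) ≡ suc (opposite i)
opposite-inject₁ {suc m} zero    = refl
opposite-inject₁ {suc m} (suc i) = cong inject₁ (opposite-inject₁ i)

module _ {n : ℕ} (T : LTree n) where
  open LTree T

  Compat⇒edge-condition : ∀ u v → Compat T u v →
                          w u ≢ w v × lv u ≢ lv v × (w u < w v ⇔ lv u < lv v)
  Compat⇒edge-condition u v (inj₁ (lv< , w<)) =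
    <⇒≢ w< , <⇒≢ lv< , mk⇔ (λ _ → lv<) (λ _ → w<)
  Compat⇒edge-condition u v (inj₂ (lv> , w>)) =
    ≢-sym (<⇒≢ w>) , ≢-sym (<⇒≢ lv>) ,
    mk⇔ (λ w< → ⊥-elim (<-asym w< w>)) (λ lv< → ⊥-elim (<-asym lv< lv>))

module Construction (n : ℕ) (a b : Fin n → ℕ) where
  open Psi n a b

  V : Set
  V = Fin (suc n)

  _⋈_ : V → V → Set
  _⋈_ = Compat (ψ n a b)

  _≺_ : V → V → Set
  x ≺ y = wψ x < wψ y ⊎ (wψ x ≡ wψ y × lvψ y < lvψ x)

  _≺*_ : V → V → Set
  x ≺* y = wψ x < wψ y ⊎ (wψ x ≡ wψ y × lvψ y < lvψ x)
         ⊎ (wψ x ≡ wψ y × lvψ x ≡ lvψ y × toℕ x < toℕ y)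

  -- The Boolean tests compatᵇ and precᵇ of ψ are, definitionally, the decisions below.
  _⋈?_ : ∀ x y → Dec (x ⋈ y)
  x ⋈? y = (lvψ x <? lvψ y ×-dec wψ x <? wψ y) ⊎-dec (lvψ y <? lvψ x ×-dec wψ y <? wψ x)

  _≺*?_ : ∀ x y → Dec (x ≺* y)
  x ≺*? y = wψ x <? wψ y
          ⊎-dec (wψ x ≟ℕ wψ y ×-dec lvψ y <? lvψ x)
          ⊎-dec (wψ x ≟ℕ wψ y ×-dec lvψ x ≟ℕ lvψ y ×-dec toℕ x <? toℕ y)

  ≺⇒≺* : ∀ {x y} → x ≺ y → x ≺* y
  ≺⇒≺* (inj₁ w<) = inj₁ w<
  ≺⇒≺* (inj₂ p)  = inj₂ (inj₁ p)

  ≺*⇒≺ : ∀ {x y} → x ≺* y → toℕ y ≤ toℕ x → x ≺ y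
  ≺*⇒≺ (inj₁ w<)                 _   = inj₁ w<
  ≺*⇒≺ (inj₂ (inj₁ p))           _   = inj₂ p
  ≺*⇒≺ (inj₂ (inj₂ (_ , _ , x<y))) y≤x = ⊥-elim (<⇒≱ x<y y≤x)

  ≺-trans : ∀ {x y z} → x ≺ y → y ≺ z → x ≺ z
  ≺-trans (inj₁ w<)         (inj₁ w<′)          = inj₁ (<-trans w< w<′)
  ≺-trans (inj₁ w<)         (inj₂ (w≡′ , _))    = inj₁ (<-≤-trans w< (≤-reflexive w≡′))
  ≺-trans (inj₂ (w≡ , _))   (inj₁ w<′)          = inj₁ (≤-<-trans (≤-reflexive w≡) w<′)
  ≺-trans (inj₂ (w≡ , lv>)) (inj₂ (w≡′ , lv>′)) = inj₂ (trans w≡ w≡′ , <-trans lv>′ lv>)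

  ≺⇒≢ : ∀ {x y} → x ≺ y → ¬ (wψ x ≡ wψ y × lvψ x ≡ lvψ y)
  ≺⇒≢ (inj₁ w<)       (w≡ , _)  = <⇒≢ w< w≡
  ≺⇒≢ (inj₂ (_ , lv>)) (_ , lv≡) = <⇒≢ lv> (sym lv≡)

  ¬≺*root : ∀ {x} → 1 ≤ wψ x → ¬ x ≺* zero
  ¬≺*root w≥1 (inj₁ ())
  ¬≺*root w≥1 (inj₂ (inj₁ (w≡0 , _)))     = <⇒≢ w≥1 (sym w≡0)
  ¬≺*root w≥1 (inj₂ (inj₂ (w≡0 , _ , _))) = <⇒≢ w≥1 (sym w≡0)

  StopsAt : V → V → V → Set
  StopsAt x u c = x ⋈ u × x ≺* c

  stopsAt? : ∀ x u c → Dec (StopsAt x u c)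
  stopsAt? x u c = x ⋈? u ×-dec x ≺*? c

  choose-cases : ∀ (Pr : V → Set) x u c us →
                 (StopsAt x u c → Pr u) → (¬ StopsAt x u c → Pr (choose x (c ∷ us))) →
                 Pr (choose x (u ∷ c ∷ us))
  choose-cases Pr x u c us = if-does Pr (stopsAt? x u c)

  choose-satisfies : ∀ {Pr : V → Set} x us → Pr zero → All Pr us → Pr (choose x us)
  choose-satisfies x []           P₀ []       = P₀
  choose-satisfies x (u ∷ [])     P₀ (pu ∷ []) = pu
  choose-satisfies {Pr} x (u ∷ c ∷ us) P₀ (pu ∷ ps) =
    choose-cases Pr x u c us (λ _ → pu) (λ _ → choose-satisfies x (c ∷ us) P₀ ps)

  Decreasing : (V → V) → Set
  Decreasing p = ∀ j → toℕ (p (suc j)) ≤ toℕ j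

  pathTo-cong : ∀ f {p q} v → Decreasing p →
                (∀ j → toℕ j < toℕ v → p (suc j) ≡ q (suc j)) → pathTo f p v ≡ pathTo f q v
  pathTo-cong zero                v       _   _     = refl
  pathTo-cong (suc f)             zero    _   _     = refl
  pathTo-cong (suc f) {p} {q} (suc j) dec agree = cong (_∷ʳ suc j) (begin
    pathTo f p (p (suc j)) ≡⟨ pathTo-cong f (p (suc j)) dec agree-below ⟩
    pathTo f q (p (suc j)) ≡⟨ cong (pathTo f q) (agree j ≤-refl) ⟩
    pathTo f q (q (suc j)) ∎)
    where
    open ≡-Reasoning
    agree-below : ∀ i → toℕ i < toℕ (p (suc j)) → p (suc i) ≡ q (suc i)
    agree-below i i< = agree i (<-≤-trans i< (m≤n⇒m≤1+n (dec j)))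

  pathTo-bounded : ∀ f {p} v → Decreasing p → All (λ u → toℕ u ≤ toℕ v) (pathTo f p v)
  pathTo-bounded zero        v       _   = ≤-refl ∷ []
  pathTo-bounded (suc f)     zero    _   = ≤-refl ∷ []
  pathTo-bounded (suc f) {p} (suc j) dec =
    ∷ʳ⁺ (All.map (λ u≤ → ≤-trans u≤ (m≤n⇒m≤1+n (dec j))) (pathTo-bounded f (p (suc j)) dec)) ≤-refl

  Attached : (V → V) → Fin n → Set
  Attached p j = p (suc j) ≡ choose (suc j) (pathTo (suc n) p (inject₁ j))

  record Built (t : ℕ) (p : V → V) : Set where
    field
      decreasing : Decreasing p
      attached   : ∀ j → toℕ j < t → Attached p j

  step-new : ∀ p j → step p j (suc j) ≡ choose (suc j) (pathTo (suc n) p (inject₁ j))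
  step-new p j with j ≟ j
  ... | yes _  = refl
  ... | no j≢j = ⊥-elim (j≢j refl)

  step-old : ∀ p j v → v ≢ suc j → step p j v ≡ p v
  step-old p j zero    _      = refl
  step-old p j (suc i) i≢j with i ≟ j
  ... | yes i≡j = ⊥-elim (i≢j (cong suc i≡j))
  ... | no _    = refl

  -- The root path of v_k only passes through v₀, …, v_k, whose parents step does not touch.
  Built-step : ∀ {t p} j → toℕ j ≡ t → Built t p → Built (suc t) (step p j)
  Built-step {p = p} j refl built = record { decreasing = decreasing′ ; attached = attached′ }
    where
    open Built built

    path-unchanged : ∀ i → toℕ i ≤ toℕ j →
                     pathTo (suc n) p (inject₁ i) ≡ pathTo (suc n) (step p j) (inject₁ i)
    path-unchanged i i≤j = pathTo-cong (suc n) (inject₁ i) decreasing λ k k< →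
      sym (step-old p j (suc k) λ k≡j → <-irrefl (cong toℕ (Finₚ.suc-injective k≡j))
        (<-≤-trans (subst (toℕ k <_) (toℕ-inject₁ i) k<) i≤j))

    new-bounded : toℕ (step p j (suc j)) ≤ toℕ j
    new-bounded = subst (λ r → toℕ r ≤ toℕ j) (sym (step-new p j))
      (choose-satisfies (suc j) _ z≤n
        (All.map (λ u≤ → ≤-trans u≤ (≤-reflexive (toℕ-inject₁ j)))
                 (pathTo-bounded (suc n) (inject₁ j) decreasing)))

    new-attached : Attached (step p j) j
    new-attached = trans (step-new p j) (cong (choose (suc j)) (path-unchanged j ≤-refl))

    decreasing′ : Decreasing (step p j)
    decreasing′ i with toℕ i ≟ℕ toℕ j
    ... | yes i≡j = subst (λ k → toℕ (step p j (suc k)) ≤ toℕ k) (sym (toℕ-injective i≡j)) new-bounded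
    ... | no i≢j  = subst (λ r → toℕ r ≤ toℕ i)
                      (sym (step-old p j (suc i) (i≢j ∘ cong toℕ ∘ Finₚ.suc-injective))) (decreasing i)

    attached′ : ∀ i → toℕ i < suc (toℕ j) → Attached (step p j) i
    attached′ i i≤j with toℕ i ≟ℕ toℕ j
    ... | yes i≡j = subst (Attached (step p j)) (sym (toℕ-injective i≡j)) new-attached
    ... | no i≢j  = begin
      step p j (suc i)
        ≡⟨ step-old p j (suc i) (i≢j ∘ cong toℕ ∘ Finₚ.suc-injective) ⟩
      p (suc i)
        ≡⟨ attached i i<j ⟩
      choose (suc i) (pathTo (suc n) p (inject₁ i))
        ≡⟨ cong (choose (suc i)) (path-unchanged i (<⇒≤ i<j)) ⟩
      choose (suc i) (pathTo (suc n) (step p j) (inject₁ i)) ∎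
      where
      open ≡-Reasoning
      i<j : toℕ i < toℕ j
      i<j = ≤∧≢⇒< (≤-pred i≤j) i≢j

  Built-parentψ : Built n parentψ
  Built-parentψ = foldl-allFin-invariant Built step Built-step
    (record { decreasing = λ _ → z≤n ; attached = λ _ () })

  P : V → V
  P = LTree.parent (ψ n a b)

  P-decreasing : Decreasing P
  P-decreasing = Built.decreasing Built-parentψ

  P-≤ : ∀ v → toℕ (P v) ≤ toℕ v
  P-≤ zero    = z≤n
  P-≤ (suc j) = m≤n⇒m≤1+n (P-decreasing j)

  P-< : ∀ j → toℕ (P (suc j)) < toℕ (suc j)
  P-< j = s≤s (P-decreasing j)

  _⊑_ : V → V → Set
  c ⊑ v = ∃ λ i → iter P i v ≡ c

  ⊑-refl : ∀ {v} → v ⊑ v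
  ⊑-refl = 0 , refl

  P-⊑ : ∀ {v} → P v ⊑ v
  P-⊑ = 1 , refl

  ⊑-trans : ∀ {c u v} → c ⊑ u → u ⊑ v → c ⊑ v
  ⊑-trans (i , refl) (k , refl) = i + k , sym (iter-+ P i k _)

  ⊑-step : ∀ {c v} → c ⊑ v → c ≡ v ⊎ c ⊑ P v
  ⊑-step (zero  , refl) = inj₁ refl
  ⊑-step (suc i , refl) = inj₂ (i , sym (iter-suc P i _))

  ⊑⇒≤ : ∀ {c v} → c ⊑ v → toℕ c ≤ toℕ v
  ⊑⇒≤ (zero  , refl) = ≤-refl
  ⊑⇒≤ (suc i , refl) = ≤-trans (P-≤ _) (⊑⇒≤ (i , refl))

  ⊑-root : ∀ {c} → c ⊑ zero → c ≡ zero
  ⊑-root c⊑0 = toℕ-injective (n≤0⇒n≡0 (⊑⇒≤ c⊑0))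

  root-⊑ : ∀ v → zero ⊑ v
  root-⊑ = <-strongInduction (zero ⊑_) λ where
    zero    _  → ⊑-refl
    (suc j) ih → ⊑-trans (ih (P-< j)) P-⊑

  ¬⊑P : ∀ j → ¬ (suc j ⊑ P (suc j))
  ¬⊑P j c⊑Pc = <⇒≱ (P-< j) (⊑⇒≤ c⊑Pc)

  Descendant⇒⊑P : ∀ {d u} → Descendant (ψ n a b) d u → u ⊑ P d
  Descendant⇒⊑P {d} (k , Pᵏ⁺¹d≡u) = k , trans (sym (iter-suc P k d)) Pᵏ⁺¹d≡u

  data Chain : V → List V → V → Set where
    end   : ∀ {u} → Chain u [] u
    child : ∀ {u c us v} → P c ≡ u → Chain c us v → Chain u (c ∷ us) v

  Chain-snoc : ∀ {u us v c} → Chain u us v → P c ≡ v → Chain u (us ∷ʳ c) c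
  Chain-snoc end             Pc≡v = child Pc≡v end
  Chain-snoc (child e chain) Pc≡v = child e (Chain-snoc chain Pc≡v)

  Chain⇒⊑ : ∀ {u us v} → Chain u us v → u ⊑ v
  Chain⇒⊑ end                = ⊑-refl
  Chain⇒⊑ (child refl chain) = ⊑-trans P-⊑ (Chain⇒⊑ chain)

  pathTo-Chain : ∀ f v → toℕ v ≤ f → ∃ λ us → pathTo (suc f) parentψ v ≡ zero ∷ us × Chain zero us v
  pathTo-Chain f       zero    _         = [] , refl , end
  pathTo-Chain (suc f) (suc j) (s≤s j≤f)
    with pathTo-Chain f (P (suc j)) (≤-trans (P-decreasing j) j≤f)
  ... | us , path≡ , chain = us ∷ʳ suc j , cong (_∷ʳ suc j) path≡ , Chain-snoc chain refl

  P-choose : ∀ j → ∃ λ us → Chain zero us (inject₁ j) × P (suc j) ≡ choose (suc j) (zero ∷ us)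
  P-choose j with pathTo-Chain n (inject₁ j) (toℕ≤pred[n] (inject₁ j))
  ... | us , path≡ , chain =
    us , chain , trans (Built.attached Built-parentψ j (toℕ<n j)) (cong (choose (suc j)) path≡)

  choose-sibling : ∀ x {u us v} → Chain u us v →
                   choose x (u ∷ us) ≡ v ⊎ ∃ λ c → P c ≡ choose x (u ∷ us) × c ⊑ v × x ≺* c
  choose-sibling x end = inj₁ refl
  choose-sibling x {u} (child {c = c} {us} {v} Pc≡u chain) =
    choose-cases (λ r → r ≡ v ⊎ ∃ λ c′ → P c′ ≡ r × c′ ⊑ v × x ≺* c′) x u c us
      (λ (_ , x≺*c) → inj₂ (c , Pc≡u , Chain⇒⊑ chain , x≺*c))
      (λ _ → choose-sibling x chain)

  choose-⊑ : ∀ x {u us v} → Chain u us v → choose x (u ∷ us) ⊑ v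
  choose-⊑ x {v = v} chain with choose-sibling x chain
  ... | inj₁ r≡v                  = subst (_⊑ v) (sym r≡v) ⊑-refl
  ... | inj₂ (c , Pc≡r , c⊑v , _) = subst (_⊑ v) Pc≡r (⊑-trans P-⊑ c⊑v)

  P-⊑-previous : ∀ j → P (suc j) ⊑ inject₁ j
  P-⊑-previous j with P-choose j
  ... | _ , chain , P≡ = subst (_⊑ inject₁ j) (sym P≡) (choose-⊑ (suc j) chain)

  -- The subtree of c is an interval of creation times, as each vertex hangs on the root path
  -- of its predecessor.
  ⊑-interval : ∀ k {c y} → c ⊑ k → toℕ c ≤ toℕ y → toℕ y ≤ toℕ k → c ⊑ y
  ⊑-interval = <-strongInduction Interval go
    where
    Interval : V → Set
    Interval k = ∀ {c y} → c ⊑ k → toℕ c ≤ toℕ y → toℕ y ≤ toℕ k → c ⊑ y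

    go : ∀ k → (∀ {k′} → toℕ k′ < toℕ k → Interval k′) → Interval k
    go k ih {c} {y} c⊑k c≤y y≤k with toℕ y ≟ℕ toℕ k
    ... | yes y≡k = subst (c ⊑_) (toℕ-injective (sym y≡k)) c⊑k
    go zero    ih c⊑k c≤y y≤k | no y≢k = ⊥-elim (y≢k (n≤0⇒n≡0 y≤k))
    go (suc j) ih c⊑k c≤y y≤k | no y≢k with ⊑-step c⊑k
    ... | inj₁ refl = ⊥-elim (y≢k (≤-antisym y≤k c≤y))
    ... | inj₂ c⊑P  = ih (s≤s (≤-reflexive (toℕ-inject₁ j))) (⊑-trans c⊑P (P-⊑-previous j)) c≤y
                        (≤-trans (≤-pred (≤∧≢⇒< y≤k y≢k)) (≤-reflexive (sym (toℕ-inject₁ j))))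

  ⊑-latest-sibling : ∀ j {k y} → suc k ⊑ inject₁ j → toℕ (suc k) ≤ toℕ y → toℕ y ≤ toℕ j →
                     P (suc k) ≡ P y → suc k ≡ y
  ⊑-latest-sibling j k⊑prev k≤y y≤j Pk≡Py
    with ⊑-step (⊑-interval (inject₁ j) k⊑prev k≤y (≤-trans y≤j (≤-reflexive (sym (toℕ-inject₁ j)))))
  ... | inj₁ k≡y  = k≡y
  ... | inj₂ k⊑Py = ⊥-elim (¬⊑P _ (subst (suc _ ⊑_) (sym Pk≡Py) k⊑Py))

  NoStopAbove : V → V → Set
  NoStopAbove x r = ∀ c → c ⊑ r → ¬ StopsAt x (P c) c

  root-NoStopAbove : ∀ {x} → 1 ≤ wψ x → NoStopAbove x zero
  root-NoStopAbove w≥1 c c⊑0 (_ , x≺*c) = ¬≺*root w≥1 (subst (_ ≺*_) (⊑-root c⊑0) x≺*c)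

  choose-NoStopAbove : ∀ x {u us v} → Chain u us v →
                       NoStopAbove x u → NoStopAbove x (choose x (u ∷ us))
  choose-NoStopAbove x end above = above
  choose-NoStopAbove x {u} (child {c = c} {us} Pc≡u chain) above =
    choose-cases (NoStopAbove x) x u c us
      (λ _ → above) (λ ¬stop → choose-NoStopAbove x chain (extend ¬stop))
    where
    extend : ¬ StopsAt x u c → NoStopAbove x c
    extend ¬stop d d⊑c with ⊑-step d⊑c
    ... | inj₁ refl = subst (λ p → ¬ StopsAt x p d) (sym Pc≡u) ¬stop
    ... | inj₂ d⊑Pc = above d (subst (d ⊑_) Pc≡u d⊑Pc)

  -- u lies weakly north-west of x, reading w as the horizontal and lv as the vertical coordinate.
  record NW (x u : V) : Set where
    constructor nw
    field
      west  : wψ u ≤ wψ x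
      north : lvψ x ≤ lvψ u

  ¬≺*⇒⋈⊎NW : ∀ {x y} → ¬ x ≺* y → x ⋈ y ⊎ NW x y
  ¬≺*⇒⋈⊎NW {x} {y} x⊀y with wψ x <? wψ y | lvψ y <? lvψ x
  ... | yes w< | _       = ⊥-elim (x⊀y (inj₁ w<))
  ... | no w≮  | yes lv< =
    inj₁ (inj₂ (lv< , ≤∧≢⇒< (≮⇒≥ w≮) λ w≡ → x⊀y (inj₂ (inj₁ (sym w≡ , lv<)))))
  ... | no w≮  | no lv≮  = inj₂ (nw (≮⇒≥ w≮) (≮⇒≥ lv≮))

  NW-child : ∀ {x u c} → NW x u → c ⋈ u → x ⋈ c ⊎ NW x c
  NW-child {x} {u} {c} (nw w≤ lv≤) (inj₁ (lv< , w<)) with lvψ c <? lvψ x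
  ... | yes lv<′ = inj₁ (inj₂ (lv<′ , <-≤-trans w< w≤))
  ... | no lv≮   = inj₂ (nw (<⇒≤ (<-≤-trans w< w≤)) (≮⇒≥ lv≮))
  NW-child {x} {u} {c} (nw w≤ lv≤) (inj₂ (lv> , w>)) with wψ x <? wψ c
  ... | yes w<′ = inj₁ (inj₁ (≤-<-trans lv≤ lv> , w<′))
  ... | no w≮   = inj₂ (nw (≮⇒≥ w≮) (<⇒≤ (≤-<-trans lv≤ lv>)))

  NW⇒¬descent : ∀ {x v} → NW x v → ¬ (wψ x < wψ v ⊎ lvψ v < lvψ x)
  NW⇒¬descent (nw w≤ _)  (inj₁ w<)  = <⇒≱ w< w≤
  NW⇒¬descent (nw _ lv≤) (inj₂ lv<) = <⇒≱ lv< lv≤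

  module _ (w-pos  : ∀ j → 1 ≤ wψ (suc j))
           (lv-pos : ∀ j → 1 ≤ lvψ (suc j))
           (descent : ∀ j → wψ (suc j) < wψ (inject₁ j) ⊎ lvψ (inject₁ j) < lvψ (suc j)) where

    root-⋈ : ∀ j → suc j ⋈ zero
    root-⋈ j = inj₂ (lv-pos j , w-pos j)

    -- Walking down the chain without stopping, suc j stays ⋈-comparable to or north-west of the
    -- current vertex; the descent condition at the last vertex excludes north-west.
    choose-⋈ : ∀ j {u us v} → Chain u us v → (∀ y → y ⊑ v → y ≢ zero → y ⋈ P y) →
               suc j ⋈ u ⊎ NW (suc j) u → (wψ (suc j) < wψ v ⊎ lvψ v < lvψ (suc j)) →
               suc j ⋈ choose (suc j) (u ∷ us)
    choose-⋈ j end edges (inj₁ x⋈v) _   = x⋈v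
    choose-⋈ j end edges (inj₂ x↖v) dsc = ⊥-elim (NW⇒¬descent x↖v dsc)
    choose-⋈ j {u} (child {c = c} {us} Pc≡u chain) edges here dsc =
      choose-cases (suc j ⋈_) (suc j) u c us
        proj₁ (λ ¬stop → choose-⋈ j chain edges (next ¬stop here) dsc)
      where
      next : ¬ StopsAt (suc j) u c → suc j ⋈ u ⊎ NW (suc j) u → suc j ⋈ c ⊎ NW (suc j) c
      next ¬stop (inj₁ x⋈u) = ¬≺*⇒⋈⊎NW λ x≺*c → ¬stop (x⋈u , x≺*c)
      next ¬stop (inj₂ x↖u) = NW-child x↖u (subst (c ⋈_) Pc≡u (edges c (Chain⇒⊑ chain) c≢0))
        where
        c≢0 : c ≢ zero
        c≢0 refl = <⇒≱ (lv-pos j) (subst (λ r → lvψ (suc j) ≤ lvψ r) (sym Pc≡u) (NW.north x↖u))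

    edge-⋈ : ∀ j → suc j ⋈ P (suc j)
    edge-⋈ = <-strongInduction (λ j → suc j ⋈ P (suc j)) go
      where
      go : ∀ j → (∀ {i} → toℕ i < toℕ j → suc i ⋈ P (suc i)) → suc j ⋈ P (suc j)
      go j ih with P-choose j
      ... | _ , chain , P≡ =
        subst (suc j ⋈_) (sym P≡) (choose-⋈ j chain earlier (inj₁ (root-⋈ j)) (descent j))
        where
        earlier : ∀ y → y ⊑ inject₁ j → y ≢ zero → y ⋈ P y
        earlier zero    _   y≢0 = ⊥-elim (y≢0 refl)
        earlier (suc i) i⊑j _   = ih (≤-trans (⊑⇒≤ i⊑j) (≤-reflexive (toℕ-inject₁ j)))

    parent-NoStopAbove : ∀ j → NoStopAbove (suc j) (P (suc j))
    parent-NoStopAbove j with P-choose j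
    ... | _ , chain , P≡ =
      subst (NoStopAbove (suc j)) (sym P≡)
        (choose-NoStopAbove (suc j) chain (root-NoStopAbove (w-pos j)))

    no-inversions : NoInversions (ψ n a b)
    no-inversions u v (desc , v⋈Pu , v≺u) =
      parent-NoStopAbove v (suc u) (Descendant⇒⊑P desc) (v⋈Pu , ≺⇒≺* v≺u)

    path-sibling : ∀ j → P (suc j) ≡ inject₁ j ⊎
                   ∃ λ k → toℕ k < toℕ j × suc k ⊑ inject₁ j × P (suc k) ≡ P (suc j) × suc j ≺ suc k
    path-sibling j with P-choose j
    ... | _ , chain , P≡ with choose-sibling (suc j) chain
    ... | inj₁ r≡prev = inj₁ (trans P≡ r≡prev)
    ... | inj₂ (zero , _ , _ , j≺*root) = ⊥-elim (¬≺*root (w-pos j) j≺*root)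
    ... | inj₂ (suc k , Pk≡r , k⊑prev , j≺*k) =
      inj₂ (k , k<j , k⊑prev , trans Pk≡r (sym P≡) , ≺*⇒≺ j≺*k (<⇒≤ (s≤s k<j)))
      where
      k<j : toℕ k < toℕ j
      k<j = ≤-trans (⊑⇒≤ k⊑prev) (≤-reflexive (toℕ-inject₁ j))

    -- Every older sibling of suc j is the sibling suc k on the root path of v_j, or older than it.
    siblings-ordered : ∀ j {i} → toℕ i < toℕ j → P (suc j) ≡ P (suc i) → suc j ≺ suc i
    siblings-ordered = <-strongInduction Ordered go
      where
      Ordered : Fin n → Set
      Ordered j = ∀ {i} → toℕ i < toℕ j → P (suc j) ≡ P (suc i) → suc j ≺ suc i

      go : ∀ j → (∀ {k} → toℕ k < toℕ j → Ordered k) → Ordered j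
      go j ih {i} i<j Pj≡Pi with path-sibling j
      ... | inj₁ P≡prev = ⊥-elim (<-irrefl
            (trans (cong toℕ (trans (sym Pj≡Pi) P≡prev)) (toℕ-inject₁ j))
            (≤-<-trans (P-decreasing i) i<j))
      ... | inj₂ (k , k<j , k⊑prev , Pk≡Pj , j≺k) with toℕ k ≤? toℕ i
      ... | yes k≤i =
        subst (suc j ≺_) (⊑-latest-sibling j k⊑prev (s≤s k≤i) i<j (trans Pk≡Pj Pj≡Pi)) j≺k
      ... | no k≰i  = ≺-trans j≺k (ih k<j (≰⇒> k≰i) (trans Pk≡Pj Pj≡Pi))

    siblings-distinct : ∀ i j → i ≢ j → P (suc i) ≡ P (suc j) →
                        ¬ (wψ (suc i) ≡ wψ (suc j) × lvψ (suc i) ≡ lvψ (suc j))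
    siblings-distinct i j i≢j Pi≡Pj with <-cmp (toℕ i) (toℕ j)
    ... | tri< i<j _ _ = λ (w≡ , lv≡) →
                           ≺⇒≢ (siblings-ordered j i<j (sym Pi≡Pj)) (sym w≡ , sym lv≡)
    ... | tri≈ _ i≡j _ = ⊥-elim (i≢j (toℕ-injective i≡j))
    ... | tri> _ _ j<i = ≺⇒≢ (siblings-ordered i j<i Pi≡Pj)

    ψ-InZRTT0 : InZRTT0 (ψ n a b)
    ψ-InZRTT0 =
      ( root-⊑
      , (refl , refl)
      , (λ j → w-pos j , lv-pos j)
      , (λ j _ → Compat⇒edge-condition (ψ n a b) (suc j) (P (suc j)) (edge-⋈ j))
      , siblings-distinct )
      , no-inversions

module _ {n : ℕ} {a b : Fin n → ℕ} (D : IsZLD2 n a b) where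
  open Psi n a b

  private
    a-pos = proj₁ D
    b-pos = proj₁ (proj₂ D)
    zld   = proj₂ (proj₂ D)

    b≤L : ∀ i → b i ≤ L
    b≤L = maxF-upperBound n b

  zLD2⇒w-pos : ∀ j → 1 ≤ wψ (suc j)
  zLD2⇒w-pos j = a-pos (opposite j)

  zLD2⇒lv-pos : 1 ≤ n → ∀ j → 1 ≤ lvψ (suc j)
  zLD2⇒lv-pos 1≤n j = begin
    1                      ≤⟨ minF-glb n b 1≤n b-pos ⟩
    l                      ≡⟨ m+n∸m≡n L l ⟨
    L + l ∸ L              ≤⟨ ∸-monoʳ-≤ (L + l) (b≤L (opposite j)) ⟩
    L + l ∸ b (opposite j) ∎
    where open ≤-Reasoning

  -- Vertex suc j carries the entry opposite j of D, so consecutive vertices carry consecutive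
  -- entries in reverse order, and lv reverses the order of b.
  zLD2⇒descent : 1 ≤ n → ∀ j → wψ (suc j) < wψ (inject₁ j) ⊎ lvψ (inject₁ j) < lvψ (suc j)
  zLD2⇒descent 1≤n zero    = inj₂ (zLD2⇒lv-pos 1≤n zero)
  zLD2⇒descent 1≤n (suc j) with zld (opposite (suc j)) (opposite (inject₁ j)) consecutive
    where
    consecutive : toℕ (opposite (inject₁ j)) ≡ suc (toℕ (opposite (suc j)))
    consecutive = trans (cong toℕ (opposite-inject₁ j)) (cong suc (sym (toℕ-inject₁ (opposite j))))
  ... | inj₁ a< = inj₁ a<
  ... | inj₂ b< = inj₂ (∸-monoʳ-< b< (≤-trans (b≤L _) (m≤m+n L l)))

proposition4p11 : (n : ℕ) → 1 ≤ n → (a b : Fin n → ℕ) →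
    IsZLD2 n a b → InZRTT0 (ψ n a b)
proposition4p11 n 1≤n a b D =
  Construction.ψ-InZRTT0 n a b (zLD2⇒w-pos D) (zLD2⇒lv-pos D 1≤n) (zLD2⇒descent D 1≤n)
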